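{- Let $G$ be a graph, let $A$ and $B$ be cards of $G$ obtained by deleting distinct vertices, and let $P$ be a pasting of $A$ and $B$ as members of $\mathrm{Deck}(G)$ with external vertices $u,v$, where $P-u\cong A$ and $P-v\cong B$. Let $x,y$ be vertices of $G$ with $G-x\cong A$, $G-y\cong B$, and write $d(A)=\deg_G(x)$, $d(B)=\deg_G(y)$. (i) If $|E(G)|=|E(P)|$, then $ip(2,G,x)=ip(2,P,u)$, $ip(2,G,y)=ip(2,P,v)$, $S(K_3,G,x)=S(K_3,P,u)$ and $S(K_3,G,y)=S(K_3,P,v)$. (ii) If $|E(G)|=|E(P)|+1$, then $ip(2,G,x)=ip(2,P,u)-2\,ip(2,P,u,v)+d(B)-1$, $ip(2,G,y)=ip(2,P,v)-2\,ip(2,P,v,u)+d(A)-1$, $S(K_3,G,x)=S(K_3,P,u)+ip(2,P,u,v)$ and $S(K_3,G,y)=S(K_3,P,v)+ip(2,P,v,u)$.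
   Context: Graphs are finite and simple. A card of $G$ is the isomorphism class of $G-x$; $\mathrm{Deck}(G)$ is the multiset of cards; graphs with the same deck are hypomorphs. A pasting of cards $A\cong G-v_1$, $B\cong G-v_2$ ($v_1\neq v_2$) as members of $\mathrm{Deck}(G)$ is a graph $P$ with two distinct non-adjacent vertices $u,v$ (external vertices) such that $P-u\cong A$, $P-v\cong B$ and $P$ or $P+uv$ is a hypomorph of $G$. $ip(2,G,x)$ is the number of induced paths of length 2 in $G$ having $x$ as an end vertex; $ip(2,G,x,y)$ is the number of induced $x$–$y$ paths of length 2 in $G$; $S(K_3,G,x)$ is the number of triangles of $G$ containing $x$. (The quantities $ip(2,G,x)$, $S(K_3,G,x)$, $\deg_G(x)$ depend only on the card $G-x$ and the deck, so they do not depend on the choice of $x,y$.) -}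

module Defs where

open import Data.Nat using (ℕ; zero; suc; _+_)
open import Data.Fin using (Fin; zero; suc; punchIn; toℕ)
open import Data.Fin.Properties using () renaming (_≟_ to _≟F_)
open import Data.Bool using (Bool; true; false; _∧_; _∨_; not; if_then_else_)
open import Data.Nat using (_<ᵇ_)
open import Data.Bool.Properties using (∨-comm)
open import Data.Product using (Σ; _×_; _,_; ∃-syntax)
open import Data.Sum using (_⊎_)
open import Function.Bundles using (_↔_; Inverse)
open import Relation.Binary.PropositionalEquality using (_≡_; _≢_; refl; cong₂)
open import Relation.Nullary.Decidable using (⌊_⌋)
open import Relation.Nullary using (yes; no)

record Graph (n : ℕ) : Set where
  field
    adj   : Fin n → Fin n → Bool
    adj-sym : ∀ i j → adj i j ≡ adj j i
    irref : ∀ i → adj i i ≡ false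
open Graph public

_≅_ : ∀ {n} → Graph n → Graph n → Set
_≅_ {n} G H = Σ (Fin n ↔ Fin n) λ f →
  ∀ i j → adj G i j ≡ adj H (Inverse.to f i) (Inverse.to f j)

_─_ : ∀ {n} → Graph (suc n) → Fin (suc n) → Graph n
G ─ x = record
  { adj   = λ i j → adj G (punchIn x i) (punchIn x j)
  ; adj-sym = λ i j → adj-sym G (punchIn x i) (punchIn x j)
  ; irref = λ i → irref G (punchIn x i) }

-- H is a hypomorph of G (Deck(H) = Deck(G)): there is a bijection σ of
-- the vertex sets with H - σ(i) ≅ G - i for all i.
Hypomorph : ∀ {n} → Graph (suc n) → Graph (suc n) → Set
Hypomorph {n} H G = Σ (Fin (suc n) ↔ Fin (suc n)) λ σ →
  ∀ i → (H ─ Inverse.to σ i) ≅ (G ─ i)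

eqᵇ : ∀ {n} → Fin n → Fin n → Bool
eqᵇ i j = ⌊ i ≟F j ⌋

isUV : ∀ {n} → Fin n → Fin n → Fin n → Fin n → Bool
isUV u v i j = (eqᵇ i u ∧ eqᵇ j v) ∨ (eqᵇ i v ∧ eqᵇ j u)

private
  isUV-sym : ∀ {n} (u v i j : Fin n) → isUV u v i j ≡ isUV u v j i
  isUV-sym u v i j with i ≟F u | j ≟F v | i ≟F v | j ≟F u
  ... | yes _ | yes _ | yes _ | yes _ = refl
  ... | yes _ | yes _ | yes _ | no  _ = refl
  ... | yes _ | yes _ | no  _ | yes _ = refl
  ... | yes _ | yes _ | no  _ | no  _ = refl
  ... | yes _ | no  _ | yes _ | yes _ = refl
  ... | yes _ | no  _ | yes _ | no  _ = refl
  ... | yes _ | no  _ | no  _ | yes _ = refl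
  ... | yes _ | no  _ | no  _ | no  _ = refl
  ... | no  _ | yes _ | yes _ | yes _ = refl
  ... | no  _ | yes _ | yes _ | no  _ = refl
  ... | no  _ | yes _ | no  _ | yes _ = refl
  ... | no  _ | yes _ | no  _ | no  _ = refl
  ... | no  _ | no  _ | yes _ | yes _ = refl
  ... | no  _ | no  _ | yes _ | no  _ = refl
  ... | no  _ | no  _ | no  _ | yes _ = refl
  ... | no  _ | no  _ | no  _ | no  _ = refl

  isUV-irr : ∀ {n} (u v i : Fin n) → u ≢ v → isUV u v i i ≡ false
  isUV-irr u v i u≢v with i ≟F u | i ≟F v
  ... | yes refl | yes refl = Data.Empty.⊥-elim (u≢v refl)
    where import Data.Empty
  ... | yes _ | no _ = refl
  ... | no _ | yes _ = refl
  ... | no _ | no _ = refl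

  ∨-false : ∀ {a b} → a ≡ false → b ≡ false → (a ∨ b) ≡ false
  ∨-false refl refl = refl

addEdge : ∀ {n} → Graph n → (u v : Fin n) → u ≢ v → Graph n
addEdge G u v u≢v = record
  { adj   = λ i j → adj G i j ∨ isUV u v i j
  ; adj-sym = λ i j → cong₂ _∨_ (adj-sym G i j) (isUV-sym u v i j)
  ; irref = λ i → ∨-false (irref G i) (isUV-irr u v i u≢v) }

sumFin : ∀ {n} → (Fin n → ℕ) → ℕ
sumFin {zero}  f = 0
sumFin {suc n} f = f zero + sumFin (λ i → f (suc i))

ind : Bool → ℕ
ind b = if b then 1 else 0

count : ∀ {n} → (Fin n → Bool) → ℕ
count p = sumFin (λ i → ind (p i))

ltᵇ : ∀ {n} → Fin n → Fin n → Bool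
ltᵇ i j = toℕ i <ᵇ toℕ j

numEdges : ∀ {n} → Graph n → ℕ
numEdges G = sumFin λ i → count λ j → ltᵇ i j ∧ adj G i j

deg : ∀ {n} → Graph n → Fin n → ℕ
deg G x = count (adj G x)

-- ip(2,G,x): induced paths x - w - z (x ~ w, w ~ z, z ≠ x, x ≁ z),
-- i.e. with x as an end vertex; each such path is the pair (w , z).
ip2 : ∀ {n} → Graph n → Fin n → ℕ
ip2 G x = sumFin λ w → count λ z →
  adj G x w ∧ adj G w z ∧ not (adj G x z) ∧ not (eqᵇ z x)

ip2xy : ∀ {n} → Graph n → Fin n → Fin n → ℕ
ip2xy G x y = count λ w →
  adj G x w ∧ adj G w y ∧ not (adj G x y) ∧ not (eqᵇ x y)

triangles : ∀ {n} → Graph n → Fin n → ℕ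
triangles G x = sumFin λ w → count λ z →
  ltᵇ w z ∧ adj G x w ∧ adj G w z ∧ adj G x z

CardsOfDistinct : ∀ {n} → Graph (suc n) → Graph n → Graph n → Set
CardsOfDistinct G A B =
  ∃[ v₁ ] ∃[ v₂ ] (v₁ ≢ v₂ × A ≅ (G ─ v₁) × B ≅ (G ─ v₂))

record IsPasting {n} (G : Graph (suc n)) (A B : Graph n)
                 (P : Graph (suc n)) (u v : Fin (suc n)) : Set where
  field
    u≢v     : u ≢ v
    nonadj  : adj P u v ≡ false
    del-u   : (P ─ u) ≅ A
    del-v   : (P ─ v) ≅ B
    hypo    : Hypomorph P G ⊎ Hypomorph (addEdge P u v u≢v) G

-- Given |E(G)|, the numbers deg(x), ip(2,G,x) and S(K₃,G,x) are determined by the card G − x and the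
-- deck. The degree is |E(G)| − |E(G − x)|. Since every degree is then known through its card, Σ deg² is
-- reconstructible, and expanding it over the card G − x yields the number of walks of length 2 from x.
-- The triangles at x come the same way from the total triangle count, which is reconstructible by
-- Kelly's lemma (and by inspection on at most three vertices). As ip(2,G,x) = walks₂(x) − deg(x) − 2 S(K₃,G,x),
-- all three numbers agree with those of the hypomorph of G among P and P + uv, namely the one with as
-- many edges as G. For (ii) it remains to compare P + uv with P at u: deg(u) grows by one, every common
-- neighbour of u and v becomes a triangle at u, and the walks from u gain the deg_P(v) + 1 that use uv.

module Submission where

open import Defs
open import Algebra.Bundles using (CommutativeMonoid)
import Algebra.Properties.CommutativeMonoid.Sum as CommutativeMonoidSum
import Algebra.Properties.CommutativeSemigroup as CommutativeSemigroupProperties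
open import Data.Bool using (Bool; true; false; _∧_; _∨_; not; if_then_else_)
open import Data.Bool.Properties using (∧-commutativeMonoid; ∧-comm; ∧-zeroʳ; ∧-identityʳ; ∨-identityʳ; ∨-zeroʳ; ∨-comm; T-≡; ¬-not)
open import Data.Empty using (⊥-elim)
open import Data.Fin using (Fin; zero; suc; punchIn; toℕ)
open import Data.Fin.Properties using (punchInᵢ≢i; toℕ-injective) renaming (_≟_ to _≟F_)
open import Data.Nat using (ℕ; zero; suc; _+_; _*_; _<_; _≡ᵇ_)
open import Data.Nat.Properties
open import Algebra.Properties.CommutativeSemigroup +-commutativeSemigroup using (interchange)
open import Data.Nat.Tactic.RingSolver using (solve-∀)
open import Data.Product using (_×_; _,_; proj₁; proj₂)
open import Data.Sum using (_⊎_; inj₁; inj₂)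
open import Function.Bundles using (_↔_; Inverse; Equivalence)
open import Function.Construct.Identity using (↔-id)
open import Relation.Binary using (tri<; tri≈; tri>)
open import Relation.Binary.PropositionalEquality
open import Relation.Nullary using (¬_; yes; no)
open import Relation.Nullary.Decidable using (isYes≗does; dec-true; dec-false)

private
  module FinSum = CommutativeMonoidSum +-0-commutativeMonoid
  module ∧-Props = CommutativeSemigroupProperties (CommutativeMonoid.commutativeSemigroup ∧-commutativeMonoid)

open ≡-Reasoning

-- Sums over Fin n

sumFin≡sum : ∀ {n} (f : Fin n → ℕ) → sumFin f ≡ FinSum.sum f
sumFin≡sum {zero}  f = refl
sumFin≡sum {suc n} f = cong (f zero +_) (sumFin≡sum (λ i → f (suc i)))

sumFin-cong : ∀ {n} {f g : Fin n → ℕ} → (∀ i → f i ≡ g i) → sumFin f ≡ sumFin g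
sumFin-cong {zero}  f≗g = refl
sumFin-cong {suc n} f≗g = cong₂ _+_ (f≗g zero) (sumFin-cong (λ i → f≗g (suc i)))

sumFin-zero : ∀ {n} {f : Fin n → ℕ} → (∀ i → f i ≡ 0) → sumFin f ≡ 0
sumFin-zero {zero}  f≗0 = refl
sumFin-zero {suc n} f≗0 = cong₂ _+_ (f≗0 zero) (sumFin-zero (λ i → f≗0 (suc i)))

sumFin-const : ∀ {n} c → sumFin {n} (λ _ → c) ≡ n * c
sumFin-const {zero}  c = refl
sumFin-const {suc n} c = cong (c +_) (sumFin-const {n} c)

sumFin-+ : ∀ {n} (f g : Fin n → ℕ) → sumFin (λ i → f i + g i) ≡ sumFin f + sumFin g
sumFin-+ {zero}  f g = refl
sumFin-+ {suc n} f g = trans (cong (f zero + g zero +_) (sumFin-+ (λ i → f (suc i)) (λ i → g (suc i))))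
                             (interchange (f zero) (g zero) _ _)

sumFin-* : ∀ {n} c (f : Fin n → ℕ) → sumFin (λ i → c * f i) ≡ c * sumFin f
sumFin-* {zero}  c f = sym (*-zeroʳ c)
sumFin-* {suc n} c f = trans (cong (c * f zero +_) (sumFin-* c (λ i → f (suc i))))
                             (sym (*-distribˡ-+ c (f zero) _))

sumFin-swap : ∀ {m n} (f : Fin m → Fin n → ℕ) →
              sumFin (λ i → sumFin (f i)) ≡ sumFin (λ j → sumFin (λ i → f i j))
sumFin-swap {zero} {n} f = sym (sumFin-zero {n} (λ _ → refl))
sumFin-swap {suc m} f = trans (cong (sumFin (f zero) +_) (sumFin-swap (λ i → f (suc i))))
                              (sym (sumFin-+ (f zero) (λ j → sumFin (λ i → f (suc i) j))))

sumFin-punchIn : ∀ {n} (f : Fin (suc n) → ℕ) z → sumFin f ≡ f z + sumFin (λ j → f (punchIn z j))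
sumFin-punchIn f z = begin
  sumFin f                                 ≡⟨ sumFin≡sum f ⟩
  FinSum.sum f                             ≡⟨ FinSum.sum-remove {i = z} f ⟩
  f z + FinSum.sum (λ j → f (punchIn z j)) ≡⟨ cong (f z +_) (sumFin≡sum (λ j → f (punchIn z j))) ⟨
  f z + sumFin (λ j → f (punchIn z j))     ∎

sumFin-single : ∀ {n} (f : Fin n → ℕ) z → (∀ j → j ≢ z → f j ≡ 0) → sumFin f ≡ f z
sumFin-single {suc n} f z f≡0 = begin
  sumFin f                             ≡⟨ sumFin-punchIn f z ⟩
  f z + sumFin (λ j → f (punchIn z j)) ≡⟨ cong (f z +_) (sumFin-zero (λ j → f≡0 (punchIn z j) (punchInᵢ≢i z j))) ⟩
  f z + 0                              ≡⟨ +-identityʳ (f z) ⟩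
  f z                                  ∎

sumFin-reindex : ∀ {n} (σ : Fin n ↔ Fin n) {f g : Fin n → ℕ} →
                 (∀ i → f i ≡ g (Inverse.to σ i)) → sumFin f ≡ sumFin g
sumFin-reindex σ {f} {g} f≗g∘σ = begin
  sumFin f                              ≡⟨ sumFin-cong f≗g∘σ ⟩
  sumFin (λ i → g (Inverse.to σ i))     ≡⟨ sumFin≡sum (λ i → g (Inverse.to σ i)) ⟩
  FinSum.sum (λ i → g (Inverse.to σ i)) ≡⟨ FinSum.sum-permute g σ ⟨
  FinSum.sum g                          ≡⟨ sumFin≡sum g ⟨
  sumFin g                              ∎

eqᵇ-refl : ∀ {n} (i : Fin n) → eqᵇ i i ≡ true
eqᵇ-refl i = trans (isYes≗does (i ≟F i)) (dec-true (i ≟F i) refl)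

eqᵇ-≢ : ∀ {n} {i j : Fin n} → i ≢ j → eqᵇ i j ≡ false
eqᵇ-≢ {i = i} {j} i≢j = trans (isYes≗does (i ≟F j)) (dec-false (i ≟F j) i≢j)

count-∧ : ∀ {n} a (p : Fin n → Bool) → count (λ i → a ∧ p i) ≡ ind a * count p
count-∧ true  p = sym (+-identityʳ _)
count-∧ {n} false p = sumFin-zero {n} (λ _ → refl)

ltᵇ-true : ∀ {n} {i j : Fin n} → toℕ i < toℕ j → ltᵇ i j ≡ true
ltᵇ-true i<j = Equivalence.to T-≡ (<⇒<ᵇ i<j)

ltᵇ-false : ∀ {n} {i j : Fin n} → ¬ toℕ i < toℕ j → ltᵇ i j ≡ false
ltᵇ-false {i = i} {j} i≮j = ¬-not (λ lt → i≮j (<ᵇ⇒< (toℕ i) (toℕ j) (Equivalence.from T-≡ lt)))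

module _ {n} (b : Fin n → Fin n → Bool) (b-sym : ∀ i j → b i j ≡ b j i) (b-irrefl : ∀ i → b i i ≡ false) where

  ind-split-< : ∀ i j → ind (b i j) ≡ ind (ltᵇ i j ∧ b i j) + ind (ltᵇ j i ∧ b j i)
  ind-split-< i j with <-cmp (toℕ i) (toℕ j)
  ... | tri< i<j _ j≮i rewrite ltᵇ-true i<j | ltᵇ-false j≮i = sym (+-identityʳ _)
  ... | tri> i≮j _ j<i rewrite ltᵇ-false i≮j | ltᵇ-true j<i = cong ind (b-sym i j)
  ... | tri≈ i≮j i≡j _ rewrite toℕ-injective i≡j | ltᵇ-false i≮j | b-irrefl j = refl

  sumFin-symmetric : sumFin (λ i → count (b i)) ≡ 2 * sumFin (λ i → count (λ j → ltᵇ i j ∧ b i j))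
  sumFin-symmetric = begin
    sumFin (λ i → count (b i))
      ≡⟨ sumFin-cong (λ i → trans (sumFin-cong (ind-split-< i)) (sumFin-+ (λ j → upper i j) (λ j → upper j i))) ⟩
    sumFin (λ i → sumFin (upper i) + sumFin (λ j → upper j i))
      ≡⟨ sumFin-+ (λ i → sumFin (upper i)) (λ i → sumFin (λ j → upper j i)) ⟩
    sumFin (λ i → sumFin (upper i)) + sumFin (λ i → sumFin (λ j → upper j i))
      ≡⟨ cong (sumFin (λ i → sumFin (upper i)) +_) (sumFin-swap upper) ⟨
    sumFin (λ i → sumFin (upper i)) + sumFin (λ i → sumFin (upper i))
      ≡⟨ cong (sumFin (λ i → sumFin (upper i)) +_) (+-identityʳ _) ⟨
    2 * sumFin (λ i → sumFin (upper i)) ∎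
    where
    upper : Fin n → Fin n → ℕ
    upper i j = ind (ltᵇ i j ∧ b i j)

-- Walks and triangles at a vertex

isTriangle : ∀ {n} → Graph n → Fin n → Fin n → Fin n → Bool
isTriangle H x w y = adj H x w ∧ adj H w y ∧ adj H x y

walks₂ : ∀ {n} → Graph n → Fin n → ℕ
walks₂ H z = sumFin λ w → count λ y → adj H z w ∧ adj H w y

orderedTriangles : ∀ {n} → Graph n → Fin n → ℕ
orderedTriangles H z = sumFin λ w → count (isTriangle H z w)

degreeSum : ∀ {n} → Graph n → ℕ
degreeSum H = sumFin (deg H)

degreeSquareSum : ∀ {n} → Graph n → ℕ
degreeSquareSum H = sumFin λ i → deg H i * deg H i

orderedTriangleSum : ∀ {n} → Graph n → ℕ
orderedTriangleSum H = sumFin (orderedTriangles H)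

module _ {n} (H : Graph n) where

  isTriangle-swap₁₂ : ∀ x w y → isTriangle H x w y ≡ isTriangle H w x y
  isTriangle-swap₁₂ x w y rewrite adj-sym H w x = ∧-Props.x∙yz≈x∙zy (adj H x w) (adj H w y) (adj H x y)

  isTriangle-swap₂₃ : ∀ x w y → isTriangle H x w y ≡ isTriangle H x y w
  isTriangle-swap₂₃ x w y rewrite adj-sym H y w = ∧-Props.x∙yz≈z∙yx (adj H x w) (adj H w y) (adj H x y)

  isTriangle-x-x-y : ∀ x y → isTriangle H x x y ≡ false
  isTriangle-x-x-y x y rewrite irref H x = refl

  isTriangle-x-w-x : ∀ x w → isTriangle H x w x ≡ false
  isTriangle-x-w-x x w rewrite irref H x = trans (cong (adj H x w ∧_) (∧-zeroʳ (adj H w x))) (∧-zeroʳ (adj H x w))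

  isTriangle-x-w-w : ∀ x w → isTriangle H x w w ≡ false
  isTriangle-x-w-w x w = trans (isTriangle-swap₁₂ x w w) (isTriangle-x-w-x w x)

  handshake : degreeSum H ≡ 2 * numEdges H
  handshake = sumFin-symmetric (adj H) (adj-sym H) (irref H)

  orderedTriangles≡2*triangles : ∀ z → orderedTriangles H z ≡ 2 * triangles H z
  orderedTriangles≡2*triangles z = sumFin-symmetric (isTriangle H z) (isTriangle-swap₂₃ z) (isTriangle-x-w-w z)

  walks₂≡sum-deg : ∀ z → walks₂ H z ≡ sumFin (λ w → ind (adj H z w) * deg H w)
  walks₂≡sum-deg z = sumFin-cong (λ w → count-∧ (adj H z w) (adj H w))

  -- A walk z–w–y of length 2 either returns to z, closes a triangle, or is an induced path.
  walks₂-split : ∀ z → ip2 H z + deg H z + orderedTriangles H z ≡ walks₂ H z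
  walks₂-split z = begin
    ip2 H z + deg H z + orderedTriangles H z
      ≡⟨ cong (_+ orderedTriangles H z) (sumFin-+ path (λ w → ind (adj H z w))) ⟨
    sumFin (λ w → path w + ind (adj H z w)) + orderedTriangles H z
      ≡⟨ sumFin-+ (λ w → path w + ind (adj H z w)) (λ w → count (isTriangle H z w)) ⟨
    sumFin (λ w → path w + ind (adj H z w) + count (isTriangle H z w))
      ≡⟨ sumFin-cong walks-from ⟩
    walks₂ H z ∎
    where
    path : Fin n → ℕ
    path w = count λ y → adj H z w ∧ adj H w y ∧ not (adj H z y) ∧ not (eqᵇ y z)

    classify : ∀ w y → ind (adj H z w ∧ adj H w y ∧ not (adj H z y) ∧ not (eqᵇ y z))
                       + ind (eqᵇ y z ∧ adj H z w) + ind (isTriangle H z w y)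
                     ≡ ind (adj H z w ∧ adj H w y)
    classify w y with y ≟F z
    classify w y | yes refl rewrite irref H y | adj-sym H w y with adj H y w
    ... | true  = refl
    ... | false = refl
    classify w y | no y≢z with adj H z w | adj H w y | adj H z y
    ... | true  | true  | true  = refl
    ... | true  | true  | false = refl
    ... | true  | false | _     = refl
    ... | false | _     | _     = refl

    returns : ∀ w → count (λ y → eqᵇ y z ∧ adj H z w) ≡ ind (adj H z w)
    returns w = begin
      count (λ y → eqᵇ y z ∧ adj H z w)
        ≡⟨ sumFin-single (λ y → ind (eqᵇ y z ∧ adj H z w)) z (λ y y≢z → cong (λ b → ind (b ∧ adj H z w)) (eqᵇ-≢ y≢z)) ⟩
      ind (eqᵇ z z ∧ adj H z w)
        ≡⟨ cong (λ b → ind (b ∧ adj H z w)) (eqᵇ-refl z) ⟩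
      ind (adj H z w) ∎

    walks-from : ∀ w → path w + ind (adj H z w) + count (isTriangle H z w) ≡ count (λ y → adj H z w ∧ adj H w y)
    walks-from w = begin
      path w + ind (adj H z w) + count (isTriangle H z w)
        ≡⟨ cong (λ r → path w + r + count (isTriangle H z w)) (returns w) ⟨
      path w + count (λ y → eqᵇ y z ∧ adj H z w) + count (isTriangle H z w)
        ≡⟨ cong (_+ count (isTriangle H z w)) (sumFin-+ _ (λ y → ind (eqᵇ y z ∧ adj H z w))) ⟨
      sumFin (λ y → ind (adj H z w ∧ adj H w y ∧ not (adj H z y) ∧ not (eqᵇ y z)) + ind (eqᵇ y z ∧ adj H z w))
        + count (isTriangle H z w)
        ≡⟨ sumFin-+ _ (λ y → ind (isTriangle H z w y)) ⟨
      sumFin (λ y → ind (adj H z w ∧ adj H w y ∧ not (adj H z y) ∧ not (eqᵇ y z))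
                    + ind (eqᵇ y z ∧ adj H z w) + ind (isTriangle H z w y))
        ≡⟨ sumFin-cong (classify w) ⟩
      count (λ y → adj H z w ∧ adj H w y) ∎

-- Isomorphism and vertex deletion

≅-refl : ∀ {n} {H : Graph n} → H ≅ H
≅-refl {n} = ↔-id (Fin n) , λ _ _ → refl

≗⇒≅ : ∀ {n} {H K : Graph n} → (∀ i j → adj H i j ≡ adj K i j) → H ≅ K
≗⇒≅ {n} H≗K = ↔-id (Fin n) , H≗K

≗-≅-trans : ∀ {n} {H K L : Graph n} → (∀ i j → adj H i j ≡ adj K i j) → K ≅ L → H ≅ L
≗-≅-trans H≗K (σ , σ-adj) = σ , λ i j → trans (H≗K i j) (σ-adj i j)

module _ {n} (H K : Graph n) (H≅K : H ≅ K) where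
  private
    σ = proj₁ H≅K
    σ-adj = proj₂ H≅K

  deg-≅ : ∀ i → deg H i ≡ deg K (Inverse.to σ i)
  deg-≅ i = sumFin-reindex σ (λ j → cong ind (σ-adj i j))

  orderedTriangles-≅ : ∀ z → orderedTriangles H z ≡ orderedTriangles K (Inverse.to σ z)
  orderedTriangles-≅ z = sumFin-reindex σ λ w → sumFin-reindex σ λ y →
    cong ind (cong₂ _∧_ (σ-adj z w) (cong₂ _∧_ (σ-adj w y) (σ-adj z y)))

  numEdges-≅ : numEdges H ≡ numEdges K
  numEdges-≅ = *-cancelˡ-≡ _ _ 2 (trans (sym (handshake H)) (trans (sumFin-reindex σ deg-≅) (handshake K)))

  degreeSquareSum-≅ : degreeSquareSum H ≡ degreeSquareSum K
  degreeSquareSum-≅ = sumFin-reindex σ (λ i → cong₂ _*_ (deg-≅ i) (deg-≅ i))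

  orderedTriangleSum-≅ : orderedTriangleSum H ≡ orderedTriangleSum K
  orderedTriangleSum-≅ = sumFin-reindex σ orderedTriangles-≅

module _ {n} (H : Graph (suc n)) (z : Fin (suc n)) where

  deg-punchIn : ∀ j → deg H (punchIn z j) ≡ ind (adj H z (punchIn z j)) + deg (H ─ z) j
  deg-punchIn j = trans (sumFin-punchIn (λ k → ind (adj H (punchIn z j) k)) z)
                        (cong (λ b → ind b + deg (H ─ z) j) (adj-sym H (punchIn z j) z))

  deg≡sum-punchIn : deg H z ≡ sumFin (λ j → ind (adj H z (punchIn z j)))
  deg≡sum-punchIn = trans (sumFin-punchIn (λ k → ind (adj H z k)) z)
                          (cong (λ b → ind b + sumFin (λ j → ind (adj H z (punchIn z j)))) (irref H z))

  degreeSum-─ : degreeSum H ≡ deg H z + deg H z + degreeSum (H ─ z)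
  degreeSum-─ = begin
    degreeSum H
      ≡⟨ sumFin-punchIn (deg H) z ⟩
    deg H z + sumFin (λ j → deg H (punchIn z j))
      ≡⟨ cong (deg H z +_) (trans (sumFin-cong deg-punchIn) (sumFin-+ _ (deg (H ─ z)))) ⟩
    deg H z + (sumFin (λ j → ind (adj H z (punchIn z j))) + degreeSum (H ─ z))
      ≡⟨ cong (λ d → deg H z + (d + degreeSum (H ─ z))) deg≡sum-punchIn ⟨
    deg H z + (deg H z + degreeSum (H ─ z))
      ≡⟨ +-assoc (deg H z) _ _ ⟨
    deg H z + deg H z + degreeSum (H ─ z) ∎

  numEdges-─ : numEdges H ≡ deg H z + numEdges (H ─ z)
  numEdges-─ = *-cancelˡ-≡ _ _ 2 (begin
    2 * numEdges H                                  ≡⟨ handshake H ⟨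
    degreeSum H                                     ≡⟨ degreeSum-─ ⟩
    deg H z + deg H z + degreeSum (H ─ z)           ≡⟨ cong (deg H z + deg H z +_) (handshake (H ─ z)) ⟩
    deg H z + deg H z + 2 * numEdges (H ─ z)        ≡⟨ factor-2 (deg H z) (numEdges (H ─ z)) ⟩
    2 * (deg H z + numEdges (H ─ z))                ∎)
    where
    factor-2 : ∀ a b → a + a + 2 * b ≡ 2 * (a + b)
    factor-2 = solve-∀

  walks₂-─ : walks₂ H z ≡ sumFin (λ j → ind (adj H z (punchIn z j)) * deg H (punchIn z j))
  walks₂-─ = begin
    walks₂ H z
      ≡⟨ walks₂≡sum-deg H z ⟩
    sumFin (λ w → ind (adj H z w) * deg H w)
      ≡⟨ sumFin-punchIn (λ w → ind (adj H z w) * deg H w) z ⟩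
    ind (adj H z z) * deg H z + sumFin (λ j → ind (adj H z (punchIn z j)) * deg H (punchIn z j))
      ≡⟨ cong (λ b → ind b * deg H z + sumFin (λ j → ind (adj H z (punchIn z j)) * deg H (punchIn z j))) (irref H z) ⟩
    sumFin (λ j → ind (adj H z (punchIn z j)) * deg H (punchIn z j)) ∎

  -- Deleting z lowers the degree of each neighbour of z by one, and the cross terms of (d + 1)² count the 2-walks from z.
  degreeSquareSum-─ : degreeSquareSum H + deg H z ≡ deg H z * deg H z + 2 * walks₂ H z + degreeSquareSum (H ─ z)
  degreeSquareSum-─ = begin
    degreeSquareSum H + deg H z
      ≡⟨ cong₂ _+_ (sumFin-punchIn (λ i → deg H i * deg H i) z) deg≡sum-punchIn ⟩
    deg H z * deg H z + sumFin (λ j → deg H (punchIn z j) * deg H (punchIn z j)) + sumFin a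
      ≡⟨ +-assoc (deg H z * deg H z) _ _ ⟩
    deg H z * deg H z + (sumFin (λ j → deg H (punchIn z j) * deg H (punchIn z j)) + sumFin a)
      ≡⟨ cong (deg H z * deg H z +_) (sumFin-+ (λ j → deg H (punchIn z j) * deg H (punchIn z j)) a) ⟨
    deg H z * deg H z + sumFin (λ j → deg H (punchIn z j) * deg H (punchIn z j) + a j)
      ≡⟨ cong (deg H z * deg H z +_) (sumFin-cong expand) ⟩
    deg H z * deg H z + sumFin (λ j → 2 * (a j * deg H (punchIn z j)) + deg (H ─ z) j * deg (H ─ z) j)
      ≡⟨ cong (deg H z * deg H z +_) (sumFin-+ (λ j → 2 * (a j * deg H (punchIn z j))) _) ⟩
    deg H z * deg H z + (sumFin (λ j → 2 * (a j * deg H (punchIn z j))) + degreeSquareSum (H ─ z))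
      ≡⟨ cong (λ s → deg H z * deg H z + (s + degreeSquareSum (H ─ z))) (trans (sumFin-* 2 (λ j → a j * deg H (punchIn z j))) (cong (2 *_) (sym walks₂-─))) ⟩
    deg H z * deg H z + (2 * walks₂ H z + degreeSquareSum (H ─ z))
      ≡⟨ +-assoc (deg H z * deg H z) _ _ ⟨
    deg H z * deg H z + 2 * walks₂ H z + degreeSquareSum (H ─ z) ∎
    where
    a : Fin n → ℕ
    a j = ind (adj H z (punchIn z j))

    square-ind : ∀ b c → (ind b + c) * (ind b + c) + ind b ≡ 2 * (ind b * (ind b + c)) + c * c
    square-ind true  = solve-∀
    square-ind false = solve-∀

    expand : ∀ j → deg H (punchIn z j) * deg H (punchIn z j) + a j
                   ≡ 2 * (a j * deg H (punchIn z j)) + deg (H ─ z) j * deg (H ─ z) j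
    expand j rewrite deg-punchIn j = square-ind (adj H z (punchIn z j)) (deg (H ─ z) j)

  orderedTriangles-via-second : orderedTriangles H z ≡ sumFin (λ j → count (isTriangle H (punchIn z j) z))
  orderedTriangles-via-second = begin
    orderedTriangles H z
      ≡⟨ sumFin-punchIn (λ w → count (isTriangle H z w)) z ⟩
    count (isTriangle H z z) + sumFin (λ j → count (isTriangle H z (punchIn z j)))
      ≡⟨ cong₂ _+_ (sumFin-zero (λ y → cong ind (isTriangle-x-x-y H z y)))
                   (sumFin-cong (λ j → sumFin-cong (λ y → cong ind (isTriangle-swap₁₂ H z (punchIn z j) y)))) ⟩
    sumFin (λ j → count (isTriangle H (punchIn z j) z)) ∎

  orderedTriangles-via-third :
    orderedTriangles H z ≡ sumFin (λ j → count (λ k → isTriangle H (punchIn z j) (punchIn z k) z))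
  orderedTriangles-via-third = begin
    orderedTriangles H z
      ≡⟨ sumFin-punchIn (λ w → count (isTriangle H z w)) z ⟩
    count (isTriangle H z z) + sumFin (λ j → count (isTriangle H z (punchIn z j)))
      ≡⟨ cong₂ _+_ (sumFin-zero (λ y → cong ind (isTriangle-x-x-y H z y)))
                   (sumFin-cong (λ j → sumFin-punchIn (λ y → ind (isTriangle H z (punchIn z j) y)) z)) ⟩
    sumFin (λ j → ind (isTriangle H z (punchIn z j) z) + count (λ k → isTriangle H z (punchIn z j) (punchIn z k)))
      ≡⟨ sumFin-cong (λ j → cong₂ _+_ (cong ind (isTriangle-x-w-x H z (punchIn z j)))
                                      (sumFin-cong (λ k → cong ind (rotate (punchIn z j) (punchIn z k))))) ⟩
    sumFin (λ j → count (λ k → isTriangle H (punchIn z j) (punchIn z k) z)) ∎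
    where
    rotate : ∀ w y → isTriangle H z w y ≡ isTriangle H w y z
    rotate w y = trans (isTriangle-swap₁₂ H z w y) (isTriangle-swap₂₃ H w z y)

  -- Every ordered triangle through z has z in exactly one of the three positions.
  orderedTriangleSum-─ : orderedTriangleSum H ≡ 3 * orderedTriangles H z + orderedTriangleSum (H ─ z)
  orderedTriangleSum-─ = begin
    orderedTriangleSum H
      ≡⟨ sumFin-punchIn (orderedTriangles H) z ⟩
    orderedTriangles H z + sumFin (λ j → orderedTriangles H (punchIn z j))
      ≡⟨ cong (orderedTriangles H z +_) (sumFin-cong split) ⟩
    orderedTriangles H z + sumFin (λ j → second j + (third j + orderedTriangles (H ─ z) j))
      ≡⟨ cong (orderedTriangles H z +_) (trans (sumFin-+ second _) (cong (sumFin second +_) (sumFin-+ third _))) ⟩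
    orderedTriangles H z + (sumFin second + (sumFin third + orderedTriangleSum (H ─ z)))
      ≡⟨ cong₂ (λ s t → orderedTriangles H z + (s + (t + orderedTriangleSum (H ─ z))))
               orderedTriangles-via-second orderedTriangles-via-third ⟨
    orderedTriangles H z + (orderedTriangles H z + (orderedTriangles H z + orderedTriangleSum (H ─ z)))
      ≡⟨ three-times (orderedTriangles H z) (orderedTriangleSum (H ─ z)) ⟩
    3 * orderedTriangles H z + orderedTriangleSum (H ─ z) ∎
    where
    second third : Fin n → ℕ
    second j = count (isTriangle H (punchIn z j) z)
    third j = count (λ k → isTriangle H (punchIn z j) (punchIn z k) z)

    three-times : ∀ a b → a + (a + (a + b)) ≡ 3 * a + b
    three-times = solve-∀

    split : ∀ j → orderedTriangles H (punchIn z j) ≡ second j + (third j + orderedTriangles (H ─ z) j)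
    split j = begin
      orderedTriangles H (punchIn z j)
        ≡⟨ sumFin-punchIn (λ w → count (isTriangle H (punchIn z j) w)) z ⟩
      second j + sumFin (λ k → count (isTriangle H (punchIn z j) (punchIn z k)))
        ≡⟨ cong (second j +_) (sumFin-cong (λ k → sumFin-punchIn (λ y → ind (isTriangle H (punchIn z j) (punchIn z k) y)) z)) ⟩
      second j + sumFin (λ k → ind (isTriangle H (punchIn z j) (punchIn z k) z) + count (isTriangle (H ─ z) j k))
        ≡⟨ cong (second j +_) (sumFin-+ _ (λ k → count (isTriangle (H ─ z) j k))) ⟩
      second j + (third j + orderedTriangles (H ─ z) j) ∎

-- Reconstruction from the deck

cardSum-hypomorph : ∀ {n} (F : Graph n → ℕ) → (∀ {X Y} → X ≅ Y → F X ≡ F Y) →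
                    {H K : Graph (suc n)} → Hypomorph K H →
                    sumFin (λ i → F (H ─ i)) ≡ sumFin (λ i → F (K ─ i))
cardSum-hypomorph F F-≅ {H} {K} (σ , cards) = sumFin-reindex σ {λ i → F (H ─ i)} {λ i → F (K ─ i)} (λ i → sym (F-≅ (cards i)))

sumFin-decomposition : ∀ {n} {Φ : ℕ} (f g : Fin n → ℕ) → (∀ i → Φ ≡ f i + g i) → sumFin f + sumFin g ≡ n * Φ
sumFin-decomposition {n} {Φ} f g Φ≡f+g = trans (sym (sumFin-+ f g)) (trans (sym (sumFin-cong Φ≡f+g)) (sumFin-const {n} Φ))

kelly : ∀ {n} k (F : Graph n → ℕ) (Φ : Graph (suc n) → ℕ) → (∀ {X Y} → X ≅ Y → F X ≡ F Y) →
        (∀ H → sumFin (λ i → F (H ─ i)) ≡ suc k * Φ H) →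
        {H K : Graph (suc n)} → Hypomorph K H → Φ H ≡ Φ K
kelly k F Φ F-≅ cardSum {H} {K} hyp =
  *-cancelˡ-≡ _ _ (suc k) (trans (sym (cardSum H)) (trans (cardSum-hypomorph F F-≅ {H} {K} hyp) (cardSum K)))

numEdges-cardSum : ∀ {k} (H : Graph (3 + k)) → sumFin (λ i → numEdges (H ─ i)) ≡ suc k * numEdges H
numEdges-cardSum {k} H = +-cancelˡ-≡ (2 * numEdges H) _ _ (begin
  2 * numEdges H + sumFin (λ i → numEdges (H ─ i)) ≡⟨ cong (_+ sumFin (λ i → numEdges (H ─ i))) (handshake H) ⟨
  degreeSum H + sumFin (λ i → numEdges (H ─ i))    ≡⟨ sumFin-decomposition (deg H) (λ i → numEdges (H ─ i)) (numEdges-─ H) ⟩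
  (3 + k) * numEdges H                             ≡⟨ split-3 k (numEdges H) ⟩
  2 * numEdges H + suc k * numEdges H              ∎)
  where
  split-3 : ∀ k e → (3 + k) * e ≡ 2 * e + suc k * e
  split-3 = solve-∀

orderedTriangleSum-cardSum : ∀ {k} (H : Graph (4 + k)) →
                             sumFin (λ i → orderedTriangleSum (H ─ i)) ≡ suc k * orderedTriangleSum H
orderedTriangleSum-cardSum {k} H = +-cancelˡ-≡ (3 * orderedTriangleSum H) _ _ (begin
  3 * orderedTriangleSum H + sumFin (λ i → orderedTriangleSum (H ─ i))
    ≡⟨ cong (_+ sumFin (λ i → orderedTriangleSum (H ─ i))) (sumFin-* 3 (orderedTriangles H)) ⟨
  sumFin (λ i → 3 * orderedTriangles H i) + sumFin (λ i → orderedTriangleSum (H ─ i))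
    ≡⟨ sumFin-decomposition (λ i → 3 * orderedTriangles H i) (λ i → orderedTriangleSum (H ─ i)) (orderedTriangleSum-─ H) ⟩
  (4 + k) * orderedTriangleSum H
    ≡⟨ split-4 k (orderedTriangleSum H) ⟩
  3 * orderedTriangleSum H + suc k * orderedTriangleSum H ∎)
  where
  split-4 : ∀ k t → (4 + k) * t ≡ 3 * t + suc k * t
  split-4 = solve-∀

numEdges-hypomorph : ∀ {k} {H K : Graph (3 + k)} → Hypomorph K H → numEdges H ≡ numEdges K
numEdges-hypomorph {k} {H} {K} = kelly k numEdges numEdges (λ {X} {Y} → numEdges-≅ X Y) numEdges-cardSum {H} {K}

orderedTriangleSum-on1 : (H : Graph 1) → orderedTriangleSum H ≡ 0
orderedTriangleSum-on1 H rewrite irref H zero = refl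

orderedTriangleSum-on2 : (H : Graph 2) → orderedTriangleSum H ≡ 0
orderedTriangleSum-on2 H rewrite irref H zero | irref H (suc zero) | adj-sym H (suc zero) zero
  with adj H zero (suc zero)
... | true  = refl
... | false = refl

-- Kelly's lemma says nothing on three vertices, but there a triangle is the same thing as three edges.
orderedTriangleSum-on3 : (H : Graph 3) → orderedTriangleSum H ≡ (if numEdges H ≡ᵇ 3 then 6 else 0)
orderedTriangleSum-on3 H
  rewrite irref H zero | irref H (suc zero) | irref H (suc (suc zero))
        | adj-sym H (suc zero) zero | adj-sym H (suc (suc zero)) zero | adj-sym H (suc (suc zero)) (suc zero)
  with adj H zero (suc zero) | adj H zero (suc (suc zero)) | adj H (suc zero) (suc (suc zero))
... | true  | true  | true  = refl
... | true  | true  | false = refl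
... | true  | false | true  = refl
... | true  | false | false = refl
... | false | true  | true  = refl
... | false | true  | false = refl
... | false | false | true  = refl
... | false | false | false = refl

orderedTriangleSum-hypomorph : ∀ {n} {H K : Graph (suc n)} → Hypomorph K H → numEdges H ≡ numEdges K →
                               orderedTriangleSum H ≡ orderedTriangleSum K
orderedTriangleSum-hypomorph {zero} {H} {K} _ _ = trans (orderedTriangleSum-on1 H) (sym (orderedTriangleSum-on1 K))
orderedTriangleSum-hypomorph {suc zero} {H} {K} _ _ = trans (orderedTriangleSum-on2 H) (sym (orderedTriangleSum-on2 K))
orderedTriangleSum-hypomorph {suc (suc zero)} {H} {K} _ edges =
  trans (orderedTriangleSum-on3 H) (trans (cong (λ e → if e ≡ᵇ 3 then 6 else 0) edges) (sym (orderedTriangleSum-on3 K)))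
orderedTriangleSum-hypomorph {suc (suc (suc k))} {H} {K} hyp _ =
  kelly k orderedTriangleSum orderedTriangleSum (λ {X} {Y} → orderedTriangleSum-≅ X Y)
        orderedTriangleSum-cardSum {H} {K} hyp

module _ {n} (H K : Graph (suc n)) (A : Graph n) (z z' : Fin (suc n))
         (H─z≅A : (H ─ z) ≅ A) (K─z'≅A : (K ─ z') ≅ A) where

  deg-card : numEdges H ≡ numEdges K → deg H z ≡ deg K z'
  deg-card edges = +-cancelʳ-≡ (numEdges A) _ _ (begin
    deg H z + numEdges A         ≡⟨ cong (deg H z +_) (numEdges-≅ (H ─ z) A H─z≅A) ⟨
    deg H z + numEdges (H ─ z)   ≡⟨ numEdges-─ H z ⟨
    numEdges H                   ≡⟨ edges ⟩
    numEdges K                   ≡⟨ numEdges-─ K z' ⟩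
    deg K z' + numEdges (K ─ z') ≡⟨ cong (deg K z' +_) (numEdges-≅ (K ─ z') A K─z'≅A) ⟩
    deg K z' + numEdges A        ∎)

  walks₂-card : deg H z ≡ deg K z' → degreeSquareSum H ≡ degreeSquareSum K → walks₂ H z ≡ walks₂ K z'
  walks₂-card deg≡ squares≡ =
    *-cancelˡ-≡ _ _ 2 (+-cancelˡ-≡ (deg H z * deg H z) _ _ (+-cancelʳ-≡ (degreeSquareSum A) _ _ (begin
      deg H z * deg H z + 2 * walks₂ H z + degreeSquareSum A
        ≡⟨ cong (deg H z * deg H z + 2 * walks₂ H z +_) (degreeSquareSum-≅ (H ─ z) A H─z≅A) ⟨
      deg H z * deg H z + 2 * walks₂ H z + degreeSquareSum (H ─ z)
        ≡⟨ degreeSquareSum-─ H z ⟨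
      degreeSquareSum H + deg H z
        ≡⟨ cong₂ _+_ squares≡ deg≡ ⟩
      degreeSquareSum K + deg K z'
        ≡⟨ degreeSquareSum-─ K z' ⟩
      deg K z' * deg K z' + 2 * walks₂ K z' + degreeSquareSum (K ─ z')
        ≡⟨ cong₂ (λ d s → d * d + 2 * walks₂ K z' + s) (sym deg≡) (degreeSquareSum-≅ (K ─ z') A K─z'≅A) ⟩
      deg H z * deg H z + 2 * walks₂ K z' + degreeSquareSum A ∎)))

  orderedTriangles-card : orderedTriangleSum H ≡ orderedTriangleSum K → orderedTriangles H z ≡ orderedTriangles K z'
  orderedTriangles-card sums≡ = *-cancelˡ-≡ _ _ 3 (+-cancelʳ-≡ (orderedTriangleSum A) _ _ (begin
    3 * orderedTriangles H z + orderedTriangleSum A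
      ≡⟨ cong (3 * orderedTriangles H z +_) (orderedTriangleSum-≅ (H ─ z) A H─z≅A) ⟨
    3 * orderedTriangles H z + orderedTriangleSum (H ─ z)
      ≡⟨ orderedTriangleSum-─ H z ⟨
    orderedTriangleSum H
      ≡⟨ sums≡ ⟩
    orderedTriangleSum K
      ≡⟨ orderedTriangleSum-─ K z' ⟩
    3 * orderedTriangles K z' + orderedTriangleSum (K ─ z')
      ≡⟨ cong (3 * orderedTriangles K z' +_) (orderedTriangleSum-≅ (K ─ z') A K─z'≅A) ⟩
    3 * orderedTriangles K z' + orderedTriangleSum A ∎))

degreeSquareSum-hypomorph : ∀ {n} {H K : Graph (suc n)} → Hypomorph K H → numEdges H ≡ numEdges K →
                            degreeSquareSum H ≡ degreeSquareSum K
degreeSquareSum-hypomorph {H = H} {K} (σ , cards) edges =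
  sumFin-reindex σ {λ i → deg H i * deg H i} {λ i → deg K i * deg K i} (λ i → cong₂ _*_ (deg≡ i) (deg≡ i))
  where
  deg≡ : ∀ i → deg H i ≡ deg K (Inverse.to σ i)
  deg≡ i = deg-card H K (H ─ i) i (Inverse.to σ i) (≅-refl {H = H ─ i}) (cards i) edges

module CardStatistics {n} (H K : Graph (suc n)) (hyp : Hypomorph K H) (edges : numEdges H ≡ numEdges K)
                      (A : Graph n) (z z' : Fin (suc n)) (H─z≅A : (H ─ z) ≅ A) (K─z'≅A : (K ─ z') ≅ A) where

  deg≡ : deg H z ≡ deg K z'
  deg≡ = deg-card H K A z z' H─z≅A K─z'≅A edges

  orderedTriangles≡ : orderedTriangles H z ≡ orderedTriangles K z'
  orderedTriangles≡ = orderedTriangles-card H K A z z' H─z≅A K─z'≅A (orderedTriangleSum-hypomorph {H = H} {K} hyp edges)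

  triangles≡ : triangles H z ≡ triangles K z'
  triangles≡ = *-cancelˡ-≡ _ _ 2 (begin
    2 * triangles H z      ≡⟨ orderedTriangles≡2*triangles H z ⟨
    orderedTriangles H z   ≡⟨ orderedTriangles≡ ⟩
    orderedTriangles K z'  ≡⟨ orderedTriangles≡2*triangles K z' ⟩
    2 * triangles K z'     ∎)

  ip2≡ : ip2 H z ≡ ip2 K z'
  ip2≡ = +-cancelʳ-≡ (deg K z' + orderedTriangles K z') _ _ (begin
    ip2 H z + (deg K z' + orderedTriangles K z')
      ≡⟨ cong₂ (λ d t → ip2 H z + (d + t)) deg≡ orderedTriangles≡ ⟨
    ip2 H z + (deg H z + orderedTriangles H z)
      ≡⟨ trans (sym (+-assoc (ip2 H z) _ _)) (walks₂-split H z) ⟩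
    walks₂ H z
      ≡⟨ walks₂-card H K A z z' H─z≅A K─z'≅A deg≡ (degreeSquareSum-hypomorph {H = H} {K} hyp edges) ⟩
    walks₂ K z'
      ≡⟨ trans (sym (walks₂-split K z')) (+-assoc (ip2 K z') _ _) ⟩
    ip2 K z' + (deg K z' + orderedTriangles K z') ∎)

-- Adding the edge uv

adjacent⇒≢ : ∀ {n} (H : Graph n) {i j} → adj H i j ≡ true → i ≢ j
adjacent⇒≢ H {i} i~i refl with () ← trans (sym i~i) (irref H i)

sumFin-punchIn-zero : ∀ {n} (f : Fin (suc n) → ℕ) z → f z ≡ 0 → sumFin f ≡ sumFin (λ j → f (punchIn z j))
sumFin-punchIn-zero f z fz≡0 = trans (sumFin-punchIn f z) (cong (_+ sumFin (λ j → f (punchIn z j))) fz≡0)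

commonNeighbours : ∀ {n} → Graph n → Fin n → Fin n → ℕ
commonNeighbours H u v = count λ w → adj H u w ∧ adj H w v

ip2xy≡commonNeighbours : ∀ {n} (H : Graph n) {u v} → u ≢ v → adj H u v ≡ false →
                         ip2xy H u v ≡ commonNeighbours H u v
ip2xy≡commonNeighbours H {u} {v} u≢v u≁v = sumFin-cong λ w →
  cong (λ b → ind (adj H u w ∧ b))
       (trans (cong₂ (λ a e → adj H w v ∧ not a ∧ not e) u≁v (eqᵇ-≢ u≢v)) (∧-identityʳ (adj H w v)))

AddsEdge : ∀ {n} → Graph n → Graph n → Fin n → Fin n → Set
AddsEdge P Q u v = ∀ i j → adj Q i j ≡ adj P i j ∨ isUV u v i j

AddsEdge-sym : ∀ {n} {P Q : Graph n} {u v} → AddsEdge P Q u v → AddsEdge P Q v u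
AddsEdge-sym {P = P} {u = u} {v} adds i j = trans (adds i j) (cong (adj P i j ∨_) (∨-comm (eqᵇ i u ∧ eqᵇ j v) _))

module Endpoint {n} (P Q : Graph (suc n)) (u v : Fin (suc n)) (u≢v : u ≢ v) (adds : AddsEdge P Q u v) where

  adj-unchanged : ∀ i j → isUV u v i j ≡ false → adj Q i j ≡ adj P i j
  adj-unchanged i j notUV = trans (adds i j) (trans (cong (adj P i j ∨_) notUV) (∨-identityʳ (adj P i j)))

  adj-Q-uv : adj Q u v ≡ true
  adj-Q-uv rewrite adds u v | eqᵇ-refl u | eqᵇ-refl v = ∨-zeroʳ (adj P u v)

  adj-Q-u : ∀ j → j ≢ v → adj Q u j ≡ adj P u j
  adj-Q-u j j≢v = adj-unchanged u j not-uv
    where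
    not-uv : isUV u v u j ≡ false
    not-uv rewrite eqᵇ-refl u | eqᵇ-≢ j≢v | eqᵇ-≢ u≢v = refl

  adj-Q-other : ∀ i j → i ≢ u → i ≢ v → adj Q i j ≡ adj P i j
  adj-Q-other i j i≢u i≢v = adj-unchanged i j (cong₂ (λ a b → (a ∧ eqᵇ j v) ∨ (b ∧ eqᵇ j u)) (eqᵇ-≢ i≢u) (eqᵇ-≢ i≢v))

  card-u : ∀ i j → adj (Q ─ u) i j ≡ adj (P ─ u) i j
  card-u i j = adj-unchanged (punchIn u i) (punchIn u j) (avoids-u (punchInᵢ≢i u i) (punchInᵢ≢i u j))
    where
    avoids-u : ∀ {i j} → i ≢ u → j ≢ u → isUV u v i j ≡ false
    avoids-u {i} {j} i≢u j≢u rewrite eqᵇ-≢ i≢u | eqᵇ-≢ j≢u = ∧-zeroʳ (eqᵇ i v)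

  deg-Q-other : ∀ w → w ≢ u → w ≢ v → deg Q w ≡ deg P w
  deg-Q-other w w≢u w≢v = sumFin-cong (λ k → cong ind (adj-Q-other w k w≢u w≢v))

  deg-u : adj P u v ≡ false → deg Q u ≡ suc (deg P u)
  deg-u u≁v = begin
    deg Q u
      ≡⟨ sumFin-punchIn (λ k → ind (adj Q u k)) v ⟩
    ind (adj Q u v) + sumFin (λ j → ind (adj Q u (punchIn v j)))
      ≡⟨ cong₂ (λ b s → ind b + s) adj-Q-uv (sumFin-cong (λ j → cong ind (adj-Q-u (punchIn v j) (punchInᵢ≢i v j)))) ⟩
    suc (sumFin (λ j → ind (adj P u (punchIn v j))))
      ≡⟨ cong suc (sumFin-punchIn-zero (λ k → ind (adj P u k)) v (cong ind u≁v)) ⟨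
    suc (deg P u) ∎

module AddEdge {n} (P Q : Graph (suc n)) (u v : Fin (suc n)) (u≢v : u ≢ v) (u≁v : adj P u v ≡ false)
               (adds : AddsEdge P Q u v) where

  open Endpoint P Q u v u≢v adds public
  private
    module V = Endpoint P Q v u (≢-sym u≢v) (AddsEdge-sym {P = P} {Q} {u} {v} adds)

  deg-v : deg Q v ≡ suc (deg P v)
  deg-v = V.deg-u (trans (adj-sym P v u) u≁v)

  numEdges-Q : numEdges Q ≡ suc (numEdges P)
  numEdges-Q = begin
    numEdges Q                       ≡⟨ numEdges-─ Q u ⟩
    deg Q u + numEdges (Q ─ u)       ≡⟨ cong₂ _+_ (deg-u u≁v) (numEdges-≅ (Q ─ u) (P ─ u) (≗⇒≅ {H = Q ─ u} {P ─ u} card-u)) ⟩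
    suc (deg P u + numEdges (P ─ u)) ≡⟨ cong suc (numEdges-─ P u) ⟨
    suc (numEdges P)                 ∎

  walks₂-u : walks₂ Q u ≡ walks₂ P u + suc (deg P v)
  walks₂-u = begin
    walks₂ Q u
      ≡⟨ walks₂≡sum-deg Q u ⟩
    sumFin (λ w → ind (adj Q u w) * deg Q w)
      ≡⟨ sumFin-punchIn (λ w → ind (adj Q u w) * deg Q w) v ⟩
    ind (adj Q u v) * deg Q v + sumFin (λ j → ind (adj Q u (punchIn v j)) * deg Q (punchIn v j))
      ≡⟨ cong₂ _+_ (cong₂ (λ b d → ind b * d) adj-Q-uv deg-v)
                   (sumFin-cong (λ j → neighbour (punchIn v j) (punchInᵢ≢i v j))) ⟩
    1 * suc (deg P v) + rest
      ≡⟨ trans (cong (_+ rest) (*-identityˡ (suc (deg P v)))) (+-comm (suc (deg P v)) rest) ⟩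
    rest + suc (deg P v)
      ≡⟨ cong (_+ suc (deg P v)) (sumFin-punchIn-zero (λ w → ind (adj P u w) * deg P w) v
                                                      (cong (λ b → ind b * deg P v) u≁v)) ⟨
    sumFin (λ w → ind (adj P u w) * deg P w) + suc (deg P v)
      ≡⟨ cong (_+ suc (deg P v)) (walks₂≡sum-deg P u) ⟨
    walks₂ P u + suc (deg P v) ∎
    where
    rest : ℕ
    rest = sumFin (λ j → ind (adj P u (punchIn v j)) * deg P (punchIn v j))

    neighbour : ∀ w → w ≢ v → ind (adj Q u w) * deg Q w ≡ ind (adj P u w) * deg P w
    neighbour w w≢v rewrite adj-Q-u w w≢v with adj P u w in u~w
    ... | false = refl
    ... | true  = cong (1 *_) (deg-Q-other w (≢-sym (adjacent⇒≢ P u~w)) w≢v)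

  triangles-through-v : count (isTriangle Q u v) ≡ commonNeighbours P u v
  triangles-through-v = sumFin-cong λ y → cong ind (trans (cong (_∧ (adj Q v y ∧ adj Q u y)) adj-Q-uv) (common y))
    where
    common : ∀ y → adj Q v y ∧ adj Q u y ≡ adj P u y ∧ adj P y v
    common y with y ≟F u | y ≟F v
    ... | yes refl | _ =
      trans (cong (adj Q v y ∧_) (irref Q y)) (trans (∧-zeroʳ (adj Q v y)) (cong (_∧ adj P y v) (sym (irref P y))))
    ... | no _ | yes refl = trans (cong (_∧ adj Q u y) (irref Q y)) (cong (_∧ adj P y y) (sym u≁v))
    ... | no y≢u | no y≢v =
      trans (cong₂ _∧_ (V.adj-Q-u y y≢u) (adj-Q-u y y≢v)) (trans (∧-comm (adj P v y) (adj P u y)) (cong (adj P u y ∧_) (adj-sym P v y)))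

  triangles-through-w : ∀ w → w ≢ v →
                        count (isTriangle Q u w) ≡ count (isTriangle P u w) + ind (adj P u w ∧ adj P w v)
  triangles-through-w w w≢v rewrite adj-Q-u w w≢v with adj P u w in u~w
  ... | false = sym (+-identityʳ _)
  ... | true  = begin
    count (λ y → adj Q w y ∧ adj Q u y)
      ≡⟨ sumFin-cong (λ y → cong (λ b → ind (b ∧ adj Q u y)) (adj-Q-other w y w≢u w≢v)) ⟩
    count (λ y → adj P w y ∧ adj Q u y)
      ≡⟨ sumFin-punchIn (λ y → ind (adj P w y ∧ adj Q u y)) v ⟩
    ind (adj P w v ∧ adj Q u v) + sumFin (λ l → ind (adj P w (punchIn v l) ∧ adj Q u (punchIn v l)))
      ≡⟨ cong₂ (λ b s → ind (adj P w v ∧ b) + s) adj-Q-uv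
               (sumFin-cong (λ l → cong (λ b → ind (adj P w (punchIn v l) ∧ b)) (adj-Q-u (punchIn v l) (punchInᵢ≢i v l)))) ⟩
    ind (adj P w v ∧ true) + rest
      ≡⟨ trans (cong (λ b → ind b + rest) (∧-identityʳ (adj P w v))) (+-comm (ind (adj P w v)) rest) ⟩
    rest + ind (adj P w v)
      ≡⟨ cong (_+ ind (adj P w v)) (sumFin-punchIn-zero (λ y → ind (adj P w y ∧ adj P u y)) v w~v∧u~v) ⟨
    count (λ y → adj P w y ∧ adj P u y) + ind (adj P w v) ∎
    where
    w≢u : w ≢ u
    w≢u = ≢-sym (adjacent⇒≢ P u~w)

    rest : ℕ
    rest = sumFin (λ l → ind (adj P w (punchIn v l) ∧ adj P u (punchIn v l)))

    w~v∧u~v : ind (adj P w v ∧ adj P u v) ≡ 0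
    w~v∧u~v = cong ind (trans (cong (adj P w v ∧_) u≁v) (∧-zeroʳ (adj P w v)))

  -- The new edge uv closes the triangle u v w for every common neighbour w, once in each order.
  orderedTriangles-u : orderedTriangles Q u ≡ orderedTriangles P u + 2 * commonNeighbours P u v
  orderedTriangles-u = begin
    orderedTriangles Q u
      ≡⟨ sumFin-punchIn (λ w → count (isTriangle Q u w)) v ⟩
    count (isTriangle Q u v) + sumFin (λ j → count (isTriangle Q u (punchIn v j)))
      ≡⟨ cong₂ _+_ triangles-through-v
               (trans (sumFin-cong (λ j → triangles-through-w (punchIn v j) (punchInᵢ≢i v j)))
                      (sumFin-+ (λ j → count (isTriangle P u (punchIn v j))) (λ j → ind (common (punchIn v j))))) ⟩
    commonNeighbours P u v + (sumFin (λ j → count (isTriangle P u (punchIn v j))) + sumFin (λ j → ind (common (punchIn v j))))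
      ≡⟨ cong₂ (λ t c → commonNeighbours P u v + (t + c))
               (sumFin-punchIn-zero (λ w → count (isTriangle P u w)) v no-triangle-uv)
               (sumFin-punchIn-zero (λ w → ind (common w)) v (cong (λ b → ind (b ∧ adj P v v)) u≁v)) ⟨
    commonNeighbours P u v + (orderedTriangles P u + commonNeighbours P u v)
      ≡⟨ twice (commonNeighbours P u v) (orderedTriangles P u) ⟩
    orderedTriangles P u + 2 * commonNeighbours P u v ∎
    where
    common : Fin (suc n) → Bool
    common w = adj P u w ∧ adj P w v

    no-triangle-uv : count (isTriangle P u v) ≡ 0
    no-triangle-uv = trans (sumFin-cong (λ y → cong (λ b → ind (b ∧ adj P v y ∧ adj P u y)) u≁v)) (sumFin-zero {suc n} (λ _ → refl))

    twice : ∀ c t → c + (t + c) ≡ t + 2 * c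
    twice = solve-∀

  triangles-u : triangles Q u ≡ triangles P u + ip2xy P u v
  triangles-u = *-cancelˡ-≡ _ _ 2 (begin
    2 * triangles Q u                                  ≡⟨ orderedTriangles≡2*triangles Q u ⟨
    orderedTriangles Q u                               ≡⟨ orderedTriangles-u ⟩
    orderedTriangles P u + 2 * commonNeighbours P u v  ≡⟨ cong₂ (λ t c → t + 2 * c) (orderedTriangles≡2*triangles P u) (sym common≡) ⟩
    2 * triangles P u + 2 * ip2xy P u v                ≡⟨ *-distribˡ-+ 2 (triangles P u) (ip2xy P u v) ⟨
    2 * (triangles P u + ip2xy P u v)                  ∎)
    where
    common≡ : ip2xy P u v ≡ commonNeighbours P u v
    common≡ = ip2xy≡commonNeighbours P u≢v u≁v

  ip2-u : ip2 Q u + 2 * ip2xy P u v ≡ ip2 P u + deg P v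
  ip2-u = +-cancelʳ-≡ (suc (deg P u) + orderedTriangles P u) _ _ (begin
    ip2 Q u + 2 * c + (suc (deg P u) + orderedTriangles P u)
      ≡⟨ shuffle (ip2 Q u) (2 * c) (deg P u) (orderedTriangles P u) ⟩
    ip2 Q u + suc (deg P u) + (orderedTriangles P u + 2 * c)
      ≡⟨ cong₂ (λ d t → ip2 Q u + d + t) (deg-u u≁v)
               (trans (orderedTriangles-u) (cong (λ c → orderedTriangles P u + 2 * c) (sym (ip2xy≡commonNeighbours P u≢v u≁v)))) ⟨
    ip2 Q u + deg Q u + orderedTriangles Q u
      ≡⟨ walks₂-split Q u ⟩
    walks₂ Q u
      ≡⟨ walks₂-u ⟩
    walks₂ P u + suc (deg P v)
      ≡⟨ cong (_+ suc (deg P v)) (walks₂-split P u) ⟨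
    ip2 P u + deg P u + orderedTriangles P u + suc (deg P v)
      ≡⟨ shuffle′ (ip2 P u) (deg P u) (orderedTriangles P u) (deg P v) ⟩
    ip2 P u + deg P v + (suc (deg P u) + orderedTriangles P u) ∎)
    where
    c : ℕ
    c = ip2xy P u v

    shuffle : ∀ q c a t → q + c + (suc a + t) ≡ q + suc a + (t + c)
    shuffle = solve-∀

    shuffle′ : ∀ p a t d → p + a + t + suc d ≡ p + d + (suc a + t)
    shuffle′ = solve-∀

graph1-≅ : (H K : Graph 1) → H ≅ K
graph1-≅ H K = ≗⇒≅ {H = H} {K} λ { zero zero → trans (irref H zero) (sym (irref K zero)) }

hypomorph-on2 : (H K : Graph 2) → Hypomorph K H
hypomorph-on2 H K = ↔-id (Fin 2) , λ i → graph1-≅ (K ─ i) (H ─ i)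

-- On two vertices the edge count does not separate P from P + uv, but there any two graphs are hypomorphic.
hypomorph-side : ∀ {n} {G P Q : Graph (suc n)} {u v : Fin (suc n)} → u ≢ v → numEdges Q ≡ suc (numEdges P) →
                 Hypomorph P G ⊎ Hypomorph Q G →
                 (numEdges G ≡ numEdges P → Hypomorph P G) × (numEdges G ≡ suc (numEdges P) → Hypomorph Q G)
hypomorph-side {zero} {u = zero} {zero} u≢v _ _ = ⊥-elim (u≢v refl)
hypomorph-side {suc zero} {G} {P} {Q} _ _ _ = (λ _ → hypomorph-on2 G P) , (λ _ → hypomorph-on2 G Q)
hypomorph-side {suc (suc k)} {G} {P} {Q} _ _ (inj₁ G~P) =
  (λ _ → G~P) , (λ more → ⊥-elim (1+n≢n (trans (sym more) (numEdges-hypomorph {k} {G} {P} G~P))))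
hypomorph-side {suc (suc k)} {G} {P} {Q} _ Q-edges (inj₂ G~Q) =
  (λ same → ⊥-elim (1+n≢n (trans (sym Q-edges) (trans (sym (numEdges-hypomorph {k} {G} {Q} G~Q)) same)))) , (λ _ → G~Q)

open import Data.Integer using (+_; _-_) renaming (_+_ to _+ℤ_)
import Data.Integer.Properties as ℤ
import Data.Integer.Tactic.RingSolver as ℤ-Solver

+≡⇒pos≡ : ∀ {q c p d D} → q + c ≡ p + d → D ≡ suc d → + q ≡ ((+ p - + c) +ℤ + D) - + 1
+≡⇒pos≡ {q} {c} {p} {d} q+c≡p+d refl = begin
  + q                              ≡⟨ cancel (+ q) (+ c) ⟩
  (+ q +ℤ + c) - + c               ≡⟨ cong (_- + c) (trans (sym (ℤ.pos-+ q c)) (trans (cong +_ q+c≡p+d) (ℤ.pos-+ p d))) ⟩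
  (+ p +ℤ + d) - + c               ≡⟨ regroup (+ p) (+ d) (+ c) ⟩
  ((+ p - + c) +ℤ (+ 1 +ℤ + d)) - + 1 ≡⟨ cong (λ t → ((+ p - + c) +ℤ t) - + 1) (ℤ.pos-+ 1 d) ⟨
  ((+ p - + c) +ℤ + suc d) - + 1   ∎
  where
  cancel : ∀ a b → a ≡ (a +ℤ b) - b
  cancel = ℤ-Solver.solve-∀
  regroup : ∀ a b c → (a +ℤ b) - c ≡ ((a - c) +ℤ (+ 1 +ℤ b)) - + 1
  regroup = ℤ-Solver.solve-∀

-- The cards need not come from distinct vertices of G.
lemma4p15 : ∀ {n} (G : Graph (suc n)) (A B : Graph n) (P : Graph (suc n))
    (u v x y : Fin (suc n))
  → CardsOfDistinct G A B
  → IsPasting G A B P u v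
  → (G ─ x) ≅ A → (G ─ y) ≅ B
  → (numEdges G ≡ numEdges P
      → ip2 G x ≡ ip2 P u × ip2 G y ≡ ip2 P v
        × triangles G x ≡ triangles P u × triangles G y ≡ triangles P v)
  × (numEdges G ≡ numEdges P + 1
      → (+ ip2 G x ≡ ((+ ip2 P u - + (2 * ip2xy P u v)) +ℤ + deg G y) - + 1)
        × (+ ip2 G y ≡ ((+ ip2 P v - + (2 * ip2xy P v u)) +ℤ + deg G x) - + 1)
        × triangles G x ≡ triangles P u + ip2xy P u v
        × triangles G y ≡ triangles P v + ip2xy P v u)
lemma4p15 {n} G A B P u v x y _ pasting G─x≅A G─y≅B = same-size , one-edge-more
  where
  open IsPasting pasting
  Q : Graph (suc n)
  Q = addEdge P u v u≢v
  module U = AddEdge P Q u v u≢v nonadj (λ _ _ → refl)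
  module V = AddEdge P Q v u (≢-sym u≢v) (trans (adj-sym P v u) nonadj) (AddsEdge-sym {P = P} {Q} {u} {v} (λ _ _ → refl))
  side : (numEdges G ≡ numEdges P → Hypomorph P G) × (numEdges G ≡ suc (numEdges P) → Hypomorph Q G)
  side = hypomorph-side {G = G} {P} {Q} u≢v U.numEdges-Q hypo

  same-size : numEdges G ≡ numEdges P →
              ip2 G x ≡ ip2 P u × ip2 G y ≡ ip2 P v × triangles G x ≡ triangles P u × triangles G y ≡ triangles P v
  same-size edges = X.ip2≡ , Y.ip2≡ , X.triangles≡ , Y.triangles≡
    where
    module X = CardStatistics G P (proj₁ side edges) edges A x u G─x≅A del-u
    module Y = CardStatistics G P (proj₁ side edges) edges B y v G─y≅B del-v

  one-edge-more : numEdges G ≡ numEdges P + 1 →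
                  (+ ip2 G x ≡ ((+ ip2 P u - + (2 * ip2xy P u v)) +ℤ + deg G y) - + 1)
                  × (+ ip2 G y ≡ ((+ ip2 P v - + (2 * ip2xy P v u)) +ℤ + deg G x) - + 1)
                  × triangles G x ≡ triangles P u + ip2xy P u v × triangles G y ≡ triangles P v + ip2xy P v u
  one-edge-more edges =
      +≡⇒pos≡ (trans (cong (_+ 2 * ip2xy P u v) X.ip2≡) U.ip2-u) (trans Y.deg≡ U.deg-v)
    , +≡⇒pos≡ (trans (cong (_+ 2 * ip2xy P v u) Y.ip2≡) V.ip2-u) (trans X.deg≡ V.deg-v)
    , trans X.triangles≡ U.triangles-u
    , trans Y.triangles≡ V.triangles-u
    where
    one-more : numEdges G ≡ suc (numEdges P)
    one-more = trans edges (+-comm (numEdges P) 1)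
    edges-Q : numEdges G ≡ numEdges Q
    edges-Q = trans one-more (sym U.numEdges-Q)
    module X = CardStatistics G Q (proj₂ side one-more) edges-Q A x u G─x≅A (≗-≅-trans {H = Q ─ u} {P ─ u} {A} U.card-u del-u)
    module Y = CardStatistics G Q (proj₂ side one-more) edges-Q B y v G─y≅B (≗-≅-trans {H = Q ─ v} {P ─ v} {B} V.card-u del-v)
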